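{- Consider a rooted tree obtained from a star with a white center and $B$ black leaves by splits and contractions, and suppose a $\mathrm{contract}(e)$ contracts the edge $e=(v,u)$, where $v$ is a child of $u$. Then: (1) if $(v,u)$ was light, then for each light child $c$ of $v$, every node in $T_c$ had its light depth decreased by $1$ by the contraction; (2) if $(v,u)$ was heavy and $v$ had a heavy child $c$ with $s(c)\le\frac12 s(u)$, then every node in $T_c$ had its light depth increased by $1$ by the contraction; (3) otherwise the contraction did not change the light depth of any node.
   Context: Nodes are black or white; $N(u)$ is the neighbour set of $u$ (including its parent), $d(u)=|N(u)|$. $\mathrm{split}(u,M)$: given a white $u$ with $d(u)\ge2$ and $M\subset N(u)$, $1\le|M|\le\frac12 d(u)$, insert a new white child $v$ of $u$; let $M'=M$ if $u$ is the root or $\mathrm{parent}(u)\notin M$, else $M'=N(u)\setminus M$; make each node of $M'$ a child of $v$. $\mathrm{contract}$ of the edge from child $v$ to parent $u$: remove $v$, make its children children of $u$, turn $u$ black. Black weight $b(u)$: $0$ if $u$ is white, else the number of original black leaves contracted to form $u$. Size $s(u)=\sum_{w\in T_u}b(w)$ with $T_u$ the subtree of $u$. An edge from child $c$ to parent $p$ is heavy if $s(c)>\frac12 s(p)$ (then $c$ is a heavy child), light otherwise. The light depth of a node is the number of light edges on its root path. -}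

module Defs where

open import Data.Nat using (ℕ; zero; suc; _+_; _*_; _≤_; _<_; _≤?_)
open import Data.Nat.Properties using (_≟_)
open import Data.Bool using (Bool; true; false; if_then_else_)
open import Data.List using (List; []; _∷_; length; filter; map; _++_; upTo; concatMap)
open import Data.Nat.ListAction using (sum)
open import Data.List.Membership.Propositional using (_∈_; _∉_)
open import Data.List.Membership.DecPropositional _≟_ using (_∈?_)
open import Data.List.Relation.Unary.Unique.Propositional using (Unique)
open import Data.List.Relation.Unary.All using (All)
open import Data.Maybe using (Maybe; just; nothing; maybe)
open import Data.Product using (Σ; _×_; _,_)
open import Relation.Nullary using (¬_; yes; no; ¬?)
open import Relation.Nullary.Decidable using (⌊_⌋)
open import Relation.Binary.PropositionalEquality using (_≡_; _≢_)

-- Rooted trees with labelled nodes (labels = node identities).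
-- Every node carries a colour and a counter; the black weight b(u) is
-- 0 for white nodes and the counter for black nodes.

data Color : Set where
  white black : Color

data Tree : Set where
  node : (lab : ℕ) → (col : Color) → (cnt : ℕ) → (kids : List Tree) → Tree

label : Tree → ℕ
label (node x _ _ _) = x

color : Tree → Color
color (node _ c _ _) = c

children : Tree → List Tree
children (node _ _ _ cs) = cs

childLabels : Tree → List ℕ
childLabels t = map label (children t)

bw : Tree → ℕ
bw (node _ white _ _) = 0
bw (node _ black k _) = k

mutual
  size : Tree → ℕ
  size (node x c k cs) = bw (node x c k cs) + sizeF cs

  sizeF : List Tree → ℕ
  sizeF [] = 0
  sizeF (t ∷ ts) = size t + sizeF ts

mutual
  labels : Tree → List ℕ
  labels (node x _ _ cs) = x ∷ labelsF cs

  labelsF : List Tree → List ℕ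
  labelsF [] = []
  labelsF (t ∷ ts) = labels t ++ labelsF ts

mutual
  find : ℕ → Tree → Maybe Tree
  find w (node x c k cs) with w ≟ x
  ... | yes _ = just (node x c k cs)
  ... | no _ = findF w cs

  findF : ℕ → List Tree → Maybe Tree
  findF w [] = nothing
  findF w (t ∷ ts) with find w t
  ... | just r = just r
  ... | nothing = findF w ts

sz : Tree → ℕ → ℕ
sz T w = maybe size 0 (find w T)

subtreeLabels : Tree → ℕ → List ℕ
subtreeLabels T w = maybe labels [] (find w T)

ChildOf : Tree → ℕ → ℕ → Set
ChildOf T c p = Σ Tree λ t → find p T ≡ just t × c ∈ childLabels t

-- the edge from child c to parent p is heavy: s(c) > s(p)/2, i.e. s(p) < 2 s(c)
HeavyEdge : Tree → ℕ → ℕ → Set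
HeavyEdge T c p = sz T p < 2 * sz T c

LightEdge : Tree → ℕ → ℕ → Set
LightEdge T c p = 2 * sz T c ≤ sz T p

-- Light depth: number of light edges on the root path.

lightBit : ℕ → ℕ → ℕ
lightBit sc sp = if ⌊ 2 * sc ≤? sp ⌋ then 1 else 0

mutual
  ldAcc : ℕ → ℕ → Tree → Maybe ℕ
  ldAcc w acc (node x c k cs) with w ≟ x
  ... | yes _ = just acc
  ... | no _ = ldF w acc (size (node x c k cs)) cs

  ldF : ℕ → ℕ → ℕ → List Tree → Maybe ℕ
  ldF w acc sp [] = nothing
  ldF w acc sp (t ∷ ts) with ldAcc w (acc + lightBit (size t) sp) t
  ... | just r = just r
  ... | nothing = ldF w acc sp ts

lightDepth : Tree → ℕ → Maybe ℕ
lightDepth T w = ldAcc w 0 T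

-- contract: contract the edge from child v to parent u: remove v,
-- make its children children of u, turn u black; u now accounts for the
-- original black leaves of both u and v, so b(u) := b(u) + b(v).

isLab : ℕ → Tree → Bool
isLab v t = ⌊ v ≟ label t ⌋

contractKids : ℕ → List Tree → List Tree
contractKids v cs = concatMap (λ t → if isLab v t then children t else t ∷ []) cs

weightOfKid : ℕ → List Tree → ℕ
weightOfKid v cs = sum (map (λ t → if isLab v t then bw t else 0) cs)

mutual
  contract : ℕ → ℕ → Tree → Tree
  contract u v (node x c k cs) with u ≟ x
  ... | yes _ = node x black (bw (node x c k cs) + weightOfKid v cs) (contractKids v cs)
  ... | no _ = node x c k (contractF u v cs)

  contractF : ℕ → ℕ → List Tree → List Tree
  contractF u v [] = []
  contractF u v (t ∷ ts) = contract u v t ∷ contractF u v ts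

mutual
  split : ℕ → ℕ → List ℕ → Tree → Tree
  split u v ms (node x c k cs) with u ≟ x
  ... | yes _ = node x c k
                  (node v white 0 (filter (λ t → label t ∈? ms) cs)
                   ∷ filter (λ t → ¬? (label t ∈? ms)) cs)
  ... | no _ = node x c k (splitF u v ms cs)

  splitF : ℕ → ℕ → List ℕ → List Tree → List Tree
  splitF u v ms [] = []
  splitF u v ms (t ∷ ts) = split u v ms t ∷ splitF u v ms ts

-- d(u) = |N(u)|: children plus the parent unless u is the root of T
-- (t is the subtree of T at u)
deg : Tree → ℕ → Tree → ℕ
deg T u t = length (childLabels t) + (if ⌊ u ≟ label T ⌋ then 0 else 1)

-- A set M ⊂ N(u) is given by (p , X): p = true iff parent(u) ∈ M, and X
-- the (duplicate-free) list of children of u in M.  |M| = [p] + |X|.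
cardM : Bool → List ℕ → ℕ
cardM p X = (if p then 1 else 0) + length X

M′ : Bool → List ℕ → Tree → List ℕ
M′ false X t = X
M′ true X t = filter (λ y → ¬? (y ∈? X)) (childLabels t)

star : ℕ → Tree
star B = node 0 white 0 (map (λ i → node (suc i) black 1 []) (upTo B))

data Reachable (B : ℕ) : Tree → Set where
  start : Reachable B (star B)
  splitStep : ∀ {T} → Reachable B T →
    (u : ℕ) (t : Tree) → find u T ≡ just t → color t ≡ white →
    (v : ℕ) → v ∉ labels T →
    (p : Bool) (X : List ℕ) → Unique X → All (_∈ childLabels t) X →
    (p ≡ true → u ≢ label T) →
    2 ≤ deg T u t → 1 ≤ cardM p X → 2 * cardM p X ≤ deg T u t →
    Reachable B (split u v (M′ p X t) T)
  contractStep : ∀ {T} → Reachable B T →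
    (u v : ℕ) → ChildOf T v u → Reachable B (contract u v T)

module Submission where

-- The proof rests on three observations.
--   * Reachable trees have pairwise distinct labels (the star does, split introduces a
--     fresh label, contract only deletes labels), so every label names one node, which
--     find locates and ldAcc assigns a light depth.
--   * Contraction preserves the size of every surviving node.  Hence the search enters
--     T_u at the same depth d before and after the contraction (descend), and nodes
--     outside T_u keep their light depth (contract-outside).
--   * Inside T_u a node below a child c of v is entered with d + bit(v→u) + bit(c→v)
--     before and d + bit(c→u) after the contraction (ldAcc-contract-through); all other
--     nodes of T_u keep their depth relative to u (ldAcc-contract-away).
-- The three claims are then bit arithmetic, carried out in the module ContractedEdge:
-- 1 + 1 against 1 in the light case, 0 + 0 against 1 for a heavy child that is light
-- with respect to u, and equal bits in every other heavy case.

open import Defs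
open import Data.Nat using (ℕ; suc; _+_; _*_; _≤_; _<_; _≤?_)
open import Data.Nat.Solver using (module +-*-Solver)
open import Data.Nat.Properties using (_≟_; +-assoc; +-comm; +-identityʳ; ≤-trans; m≤m+n; m≤n+m; <⇒≱; ≰⇒>; suc-injective)
open import Data.Bool using (true; false)
open import Data.List using (List; []; _∷_; filter; map; _++_; upTo)
open import Data.List.Properties using (++-assoc)
open import Data.List.Membership.Propositional using (_∈_; _∉_)
open import Data.List.Membership.Propositional.Properties using (∈-map⁺; ∈-map⁻; ∈-++⁻; ∈-++⁺ˡ; ∈-++⁺ʳ; ∈-filter⁻)
open import Data.List.Membership.DecPropositional _≟_ using (_∈?_)
open import Data.List.Relation.Unary.Any using (here; there)
open import Data.List.Relation.Binary.Sublist.Propositional using (_⊆_; []; _∷_; _∷ʳ_; lookup)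
open import Data.List.Relation.Binary.Sublist.Propositional.Properties using (filter-⊆)
open import Data.List.Relation.Unary.Unique.Propositional using (Unique; []; _∷_)
open import Data.List.Relation.Unary.Unique.Propositional.Properties using (upTo⁺)
import Data.List.Relation.Unary.All as All
open import Data.Maybe using (just; nothing; maybe; _<∣>_) renaming (map to mapMaybe)
open import Data.Maybe.Properties using (just-injective; <∣>-identityʳ; map-<∣>)
open import Data.Product using (Σ; _×_; _,_; proj₁; proj₂)
open import Data.Sum using (_⊎_; inj₁; inj₂)
open import Data.Unit using (⊤; tt)
open import Data.Empty using (⊥-elim)
open import Relation.Nullary using (¬_; Dec; yes; no; ¬?)
open import Relation.Nullary.Decidable using (⌊_⌋)
open import Relation.Binary.PropositionalEquality using (_≡_; _≢_; refl; sym; trans; cong; cong₂; subst; subst₂; module ≡-Reasoning)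
open +-*-Solver using (solve; _:+_; _:=_)

-- Labels are node identities, so everything rests on them being pairwise distinct.
mutual
  Distinct : Tree → Set
  Distinct (node x _ _ cs) = (x ∉ labelsF cs) × DistinctF cs

  DistinctF : List Tree → Set
  DistinctF [] = ⊤
  DistinctF (t ∷ ts) = Distinct t × DistinctF ts × (∀ {y} → y ∈ labels t → y ∉ labelsF ts)

labelsF-++ : ∀ xs ys → labelsF (xs ++ ys) ≡ labelsF xs ++ labelsF ys
labelsF-++ [] ys = refl
labelsF-++ (x ∷ xs) ys rewrite labelsF-++ xs ys = sym (++-assoc (labels x) (labelsF xs) (labelsF ys))

∈-labelsF⁺ : ∀ {t ts y} → t ∈ ts → y ∈ labels t → y ∈ labelsF ts
∈-labelsF⁺ {ts = t ∷ ts} (here refl) m = ∈-++⁺ˡ m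
∈-labelsF⁺ {ts = t ∷ ts} (there p) m = ∈-++⁺ʳ (labels t) (∈-labelsF⁺ p m)

∈-labelsF⁻ : ∀ ts {y} → y ∈ labelsF ts → Σ Tree λ t → t ∈ ts × y ∈ labels t
∈-labelsF⁻ (t ∷ ts) m with ∈-++⁻ (labels t) m
... | inj₁ m₁ = t , here refl , m₁
... | inj₂ m₂ with ∈-labelsF⁻ ts m₂
...   | t′ , t′∈ , m′ = t′ , there t′∈ , m′

label∈labels : ∀ {t w} → label t ≡ w → w ∈ labels t
label∈labels {node x _ _ _} refl = here refl

∈-labels⁻ : ∀ t {w} → w ∈ labels t → w ≡ label t ⊎ (Σ Tree λ tc → tc ∈ children t × w ∈ labels tc)
∈-labels⁻ (node _ _ _ _) (here w≡x) = inj₁ w≡x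
∈-labels⁻ (node _ _ _ cs) (there m) = inj₂ (∈-labelsF⁻ cs m)

∈-children⇒∈-labels : ∀ t {tc w} → tc ∈ children t → w ∈ labels tc → w ∈ labels t
∈-children⇒∈-labels (node _ _ _ _) tc∈ m = there (∈-labelsF⁺ tc∈ m)

shared-label⇒same : ∀ {ts t₁ t₂ y} → DistinctF ts → t₁ ∈ ts → t₂ ∈ ts →
                    y ∈ labels t₁ → y ∈ labels t₂ → t₁ ≡ t₂
shared-label⇒same _ (here refl) (here refl) _ _ = refl
shared-label⇒same (_ , _ , dj) (here refl) (there p₂) m₁ m₂ = ⊥-elim (dj m₁ (∈-labelsF⁺ p₂ m₂))
shared-label⇒same (_ , _ , dj) (there p₁) (here refl) m₁ m₂ = ⊥-elim (dj m₂ (∈-labelsF⁺ p₁ m₁))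
shared-label⇒same (_ , d , _) (there p₁) (there p₂) m₁ m₂ = shared-label⇒same d p₁ p₂ m₁ m₂

DistinctF-member : ∀ {ts t} → DistinctF ts → t ∈ ts → Distinct t
DistinctF-member (d , _ , _) (here refl) = d
DistinctF-member (_ , ds , _) (there p) = DistinctF-member ds p

labelsF-⊆ : ∀ {ts′ ts y} → ts′ ⊆ ts → y ∈ labelsF ts′ → y ∈ labelsF ts
labelsF-⊆ s m with ∈-labelsF⁻ _ m
... | t , t∈ , m′ = ∈-labelsF⁺ (lookup s t∈) m′

DistinctF-⊆ : ∀ {ts′ ts} → ts′ ⊆ ts → DistinctF ts → DistinctF ts′
DistinctF-⊆ [] _ = tt
DistinctF-⊆ (_ ∷ʳ s) (_ , ds , _) = DistinctF-⊆ s ds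
DistinctF-⊆ (refl ∷ s) (d , ds , dj) = d , DistinctF-⊆ s ds , λ m n → dj m (labelsF-⊆ s n)

DistinctF-++ : ∀ xs ys → DistinctF xs → DistinctF ys →
               (∀ {y} → y ∈ labelsF xs → y ∉ labelsF ys) → DistinctF (xs ++ ys)
DistinctF-++ [] ys _ dys _ = dys
DistinctF-++ (x ∷ xs) ys (dx , dxs , dj) dys apart =
  dx , DistinctF-++ xs ys dxs dys (λ m → apart (∈-++⁺ʳ (labels x) m)) , outside
  where
  outside : ∀ {y} → y ∈ labels x → y ∉ labelsF (xs ++ ys)
  outside m n rewrite labelsF-++ xs ys with ∈-++⁻ (labelsF xs) n
  ... | inj₁ n₁ = dj m n₁
  ... | inj₂ n₂ = apart (∈-++⁺ˡ m) n₂

find-here : ∀ {w x c k cs} → w ≡ x → find w (node x c k cs) ≡ just (node x c k cs)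
find-here {w} {x} w≡x with w ≟ x
... | yes _ = refl
... | no w≢x = ⊥-elim (w≢x w≡x)

find-skip : ∀ {w x c k cs} → w ≢ x → find w (node x c k cs) ≡ findF w cs
find-skip {w} {x} w≢x with w ≟ x
... | yes w≡x = ⊥-elim (w≢x w≡x)
... | no _ = refl

findF-cons : ∀ w t ts → findF w (t ∷ ts) ≡ (find w t <∣> findF w ts)
findF-cons w t ts with find w t
... | just _ = refl
... | nothing = refl

findF-cons⁻ : ∀ w t ts {r} → findF w (t ∷ ts) ≡ just r → find w t ≡ just r ⊎ findF w ts ≡ just r
findF-cons⁻ w t ts e with find w t
... | just _ = inj₁ e
... | nothing = inj₂ e

mutual
  find-absent : ∀ {w} t → w ∉ labels t → find w t ≡ nothing
  find-absent {w} (node x c k cs) w∉ = trans (find-skip (λ w≡x → w∉ (here w≡x))) (findF-absent cs (λ m → w∉ (there m)))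

  findF-absent : ∀ {w} ts → w ∉ labelsF ts → findF w ts ≡ nothing
  findF-absent [] _ = refl
  findF-absent {w} (t ∷ ts) w∉
    rewrite findF-cons w t ts | find-absent t (λ m → w∉ (∈-++⁺ˡ m)) = findF-absent ts (λ m → w∉ (∈-++⁺ʳ (labels t) m))

mutual
  found-label : ∀ {w} t {r} → find w t ≡ just r → label r ≡ w
  found-label {w} (node x c k cs) e with w ≟ x
  found-label (node x c k cs) refl | yes w≡x = sym w≡x
  ... | no _ = foundF-label cs e

  foundF-label : ∀ {w} ts {r} → findF w ts ≡ just r → label r ≡ w
  foundF-label {w} (t ∷ ts) e with findF-cons⁻ w t ts e
  ... | inj₁ e₁ = found-label t e₁
  ... | inj₂ e₂ = foundF-label ts e₂

mutual
  found-labels⊆ : ∀ {w} t {r} → find w t ≡ just r → ∀ {y} → y ∈ labels r → y ∈ labels t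
  found-labels⊆ {w} (node x c k cs) e m with w ≟ x
  found-labels⊆ (node x c k cs) refl m | yes _ = m
  ... | no _ = there (foundF-labels⊆ cs e m)

  foundF-labels⊆ : ∀ {w} ts {r} → findF w ts ≡ just r → ∀ {y} → y ∈ labels r → y ∈ labelsF ts
  foundF-labels⊆ {w} (t ∷ ts) e m with findF-cons⁻ w t ts e
  ... | inj₁ e₁ = ∈-++⁺ˡ (found-labels⊆ t e₁ m)
  ... | inj₂ e₂ = ∈-++⁺ʳ (labels t) (foundF-labels⊆ ts e₂ m)

found∈labels : ∀ {w} t {r} → find w t ≡ just r → w ∈ labels t
found∈labels t e = found-labels⊆ t e (label∈labels (found-label t e))

foundF∈labels : ∀ {w} ts {r} → findF w ts ≡ just r → w ∈ labelsF ts
foundF∈labels ts e = foundF-labels⊆ ts e (label∈labels (foundF-label ts e))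

mutual
  found-distinct : ∀ {w} t {r} → Distinct t → find w t ≡ just r → Distinct r
  found-distinct {w} (node x c k cs) d e with w ≟ x
  found-distinct (node x c k cs) d refl | yes _ = d
  ... | no _ = foundF-distinct cs (proj₂ d) e

  foundF-distinct : ∀ {w} ts {r} → DistinctF ts → findF w ts ≡ just r → Distinct r
  foundF-distinct {w} (t ∷ ts) (d , ds , _) e with findF-cons⁻ w t ts e
  ... | inj₁ e₁ = found-distinct t d e₁
  ... | inj₂ e₂ = foundF-distinct ts ds e₂

mutual
  find-inside : ∀ {u w} T {tu} → Distinct T → find u T ≡ just tu → w ∈ labels tu → find w T ≡ find w tu
  find-inside {u} (node x c k cs) d e m with u ≟ x
  find-inside (node x c k cs) d refl m | yes _ = refl
  ... | no _ = trans (find-skip (λ w≡x → proj₁ d (subst (_∈ labelsF cs) w≡x (foundF-labels⊆ cs e m))))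
                     (findF-inside cs (proj₂ d) e m)

  findF-inside : ∀ {u w} ts {tu} → DistinctF ts → findF u ts ≡ just tu → w ∈ labels tu → findF w ts ≡ find w tu
  findF-inside {u} {w} (t ∷ ts) {tu} (d , ds , dj) e m with findF-cons⁻ u t ts e
  ... | inj₁ e₁ rewrite findF-cons w t ts | findF-absent ts (dj (found-labels⊆ t e₁ m)) | find-inside t d e₁ m
    = <∣>-identityʳ (find w tu)
  ... | inj₂ e₂ rewrite findF-cons w t ts | find-absent t (λ m′ → dj m′ (foundF-labels⊆ ts e₂ m))
    = findF-inside ts ds e₂ m

find-self : ∀ t → find (label t) t ≡ just t
find-self (node _ _ _ _) = find-here refl

findF-member : ∀ ts {t} → DistinctF ts → t ∈ ts → findF (label t) ts ≡ just t
findF-member (t ∷ ts) _ (here refl) rewrite findF-cons (label t) t ts | find-self t = refl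
findF-member (t₀ ∷ ts) {t} (_ , ds , dj) (there p)
  rewrite findF-cons (label t) t₀ ts | find-absent t₀ (λ m → dj m (∈-labelsF⁺ p (label∈labels refl)))
  = findF-member ts ds p

find-child : ∀ T {p tp tc} → Distinct T → find p T ≡ just tp → tc ∈ children tp → find (label tc) T ≡ just tc
find-child T {tp = node y c k ds} {tc} d e tc∈ =
  trans (find-inside T d e (∈-children⇒∈-labels (node y c k ds) tc∈ root))
        (trans (find-skip (λ tc≡y → proj₁ dp (subst (_∈ labelsF ds) tc≡y (∈-labelsF⁺ tc∈ root))))
               (findF-member ds (proj₂ dp) tc∈))
  where
  dp = found-distinct T d e
  root = label∈labels {tc} refl

ldAcc-here : ∀ {w a x c k cs} → w ≡ x → ldAcc w a (node x c k cs) ≡ just a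
ldAcc-here {w} {a} {x} w≡x with w ≟ x
... | yes _ = refl
... | no w≢x = ⊥-elim (w≢x w≡x)

ldAcc-skip : ∀ {w a x c k cs} → w ≢ x → ldAcc w a (node x c k cs) ≡ ldF w a (size (node x c k cs)) cs
ldAcc-skip {w} {a} {x} w≢x with w ≟ x
... | yes w≡x = ⊥-elim (w≢x w≡x)
... | no _ = refl

ldF-cons : ∀ w a sp t ts → ldF w a sp (t ∷ ts) ≡ (ldAcc w (a + lightBit (size t) sp) t <∣> ldF w a sp ts)
ldF-cons w a sp t ts with ldAcc w (a + lightBit (size t) sp) t
... | just _ = refl
... | nothing = refl

mutual
  ldAcc-absent : ∀ {w} a t → w ∉ labels t → ldAcc w a t ≡ nothing
  ldAcc-absent a (node x c k cs) w∉ =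
    trans (ldAcc-skip (λ w≡x → w∉ (here w≡x))) (ldF-absent a _ cs (λ m → w∉ (there m)))

  ldF-absent : ∀ {w} a sp ts → w ∉ labelsF ts → ldF w a sp ts ≡ nothing
  ldF-absent a sp [] _ = refl
  ldF-absent {w} a sp (t ∷ ts) w∉
    rewrite ldF-cons w a sp t ts | ldAcc-absent (a + lightBit (size t) sp) t (λ m → w∉ (∈-++⁺ˡ m))
    = ldF-absent a sp ts (λ m → w∉ (∈-++⁺ʳ (labels t) m))

ldF-first : ∀ w a sp t ts → w ∉ labelsF ts → ldF w a sp (t ∷ ts) ≡ ldAcc w (a + lightBit (size t) sp) t
ldF-first w a sp t ts w∉ rewrite ldF-cons w a sp t ts | ldF-absent a sp ts w∉ = <∣>-identityʳ _

ldF-later : ∀ w a sp t ts → w ∉ labels t → ldF w a sp (t ∷ ts) ≡ ldF w a sp ts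
ldF-later w a sp t ts w∉ rewrite ldF-cons w a sp t ts | ldAcc-absent (a + lightBit (size t) sp) t w∉ = refl

ldF-member : ∀ {w} a sp ts {t} → DistinctF ts → t ∈ ts → w ∈ labels t →
             ldF w a sp ts ≡ ldAcc w (a + lightBit (size t) sp) t
ldF-member {w} a sp (t ∷ ts) (_ , _ , dj) (here refl) m = ldF-first w a sp t ts (dj m)
ldF-member {w} a sp (t₀ ∷ ts) (_ , ds , dj) (there p) m =
  trans (ldF-later w a sp t₀ ts (λ m₀ → dj m₀ (∈-labelsF⁺ p m))) (ldF-member a sp ts ds p m)

mutual
  ldAcc-defined : ∀ {w} a t → w ∈ labels t → Σ ℕ λ r → ldAcc w a t ≡ just r
  ldAcc-defined {w} a (node x c k cs) m with w ≟ x
  ... | yes _ = a , refl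
  ldAcc-defined a (node x c k cs) (here w≡x) | no w≢x = ⊥-elim (w≢x w≡x)
  ldAcc-defined a (node x c k cs) (there m) | no _ = ldF-defined a _ cs m

  ldF-defined : ∀ {w} a sp ts → w ∈ labelsF ts → Σ ℕ λ r → ldF w a sp ts ≡ just r
  ldF-defined {w} a sp (t ∷ ts) m rewrite ldF-cons w a sp t ts with ∈-++⁻ (labels t) m
  ... | inj₁ m₁ with ldAcc-defined (a + lightBit (size t) sp) t m₁
  ...   | r , e rewrite e = r , refl
  ldF-defined {w} a sp (t ∷ ts) m | inj₂ m₂ with ldAcc w (a + lightBit (size t) sp) t
  ...   | just r = r , refl
  ...   | nothing = ldF-defined a sp ts m₂

mutual
  ldAcc-suc : ∀ w a t → ldAcc w (suc a) t ≡ mapMaybe suc (ldAcc w a t)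
  ldAcc-suc w a (node x c k cs) with w ≟ x
  ... | yes _ = refl
  ... | no _ = ldF-suc w a _ cs

  ldF-suc : ∀ w a sp ts → ldF w (suc a) sp ts ≡ mapMaybe suc (ldF w a sp ts)
  ldF-suc w a sp [] = refl
  ldF-suc w a sp (t ∷ ts)
    rewrite ldF-cons w (suc a) sp t ts | ldF-cons w a sp t ts
          | ldAcc-suc w (a + lightBit (size t) sp) t | ldF-suc w a sp ts
    = sym (map-<∣> suc (ldAcc w (a + lightBit (size t) sp) t) (ldF w a sp ts))

data KidView (v : ℕ) (t : Tree) : Set where
  is-v  : isLab v t ≡ true → label t ≡ v → KidView v t
  not-v : isLab v t ≡ false → label t ≢ v → KidView v t

kidView : ∀ v t → KidView v t
kidView v (node y c k ds) = view (v ≟ y) refl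
  where
  view : (v≟y : Dec (v ≡ y)) → isLab v (node y c k ds) ≡ ⌊ v≟y ⌋ → KidView v (node y c k ds)
  view (yes v≡y) e = is-v e (sym v≡y)
  view (no v≢y) e = not-v e (λ y≡v → v≢y (sym y≡v))

contract-here : ∀ {u v x c k cs} → u ≡ x →
  contract u v (node x c k cs) ≡ node x black (bw (node x c k cs) + weightOfKid v cs) (contractKids v cs)
contract-here {u} {v} {x} u≡x with u ≟ x
... | yes _ = refl
... | no u≢x = ⊥-elim (u≢x u≡x)

mutual
  contract-absent : ∀ u v t → u ∉ labels t → contract u v t ≡ t
  contract-absent u v (node x c k cs) u∉ with u ≟ x
  ... | yes u≡x = ⊥-elim (u∉ (here u≡x))
  ... | no _ = cong (node x c k) (contractF-absent u v cs (λ m → u∉ (there m)))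

  contractF-absent : ∀ u v ts → u ∉ labelsF ts → contractF u v ts ≡ ts
  contractF-absent u v [] _ = refl
  contractF-absent u v (t ∷ ts) u∉ =
    cong₂ _∷_ (contract-absent u v t (λ m → u∉ (∈-++⁺ˡ m))) (contractF-absent u v ts (λ m → u∉ (∈-++⁺ʳ (labels t) m)))

-- Sizes are preserved: the weight of v moves to u, which keeps all of v's subtree.
sizeF-++ : ∀ xs ys → sizeF (xs ++ ys) ≡ sizeF xs + sizeF ys
sizeF-++ [] ys = refl
sizeF-++ (x ∷ xs) ys rewrite sizeF-++ xs ys = sym (+-assoc (size x) (sizeF xs) (sizeF ys))

contractKids-size : ∀ v cs → weightOfKid v cs + sizeF (contractKids v cs) ≡ sizeF cs
contractKids-size v [] = refl
contractKids-size v (t ∷ ts) with kidView v t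
contractKids-size v (node y c k ds ∷ ts) | is-v e _ rewrite e | sizeF-++ ds (contractKids v ts) =
  trans (interchange (bw (node y c k ds)) (weightOfKid v ts) (sizeF ds) (sizeF (contractKids v ts)))
        (cong (size (node y c k ds) +_) (contractKids-size v ts))
  where
  interchange : ∀ a b c d → (a + b) + (c + d) ≡ (a + c) + (b + d)
  interchange = solve 4 (λ a b c d → (a :+ b) :+ (c :+ d) := (a :+ c) :+ (b :+ d)) refl
contractKids-size v (t ∷ ts) | not-v e _ rewrite e =
  trans (left-comm (weightOfKid v ts) (size t) (sizeF (contractKids v ts))) (cong (size t +_) (contractKids-size v ts))
  where
  left-comm : ∀ a b c → a + (b + c) ≡ b + (a + c)
  left-comm = solve 3 (λ a b c → a :+ (b :+ c) := b :+ (a :+ c)) refl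

bw-kids : ∀ x c k ds ds′ → bw (node x c k ds) ≡ bw (node x c k ds′)
bw-kids x white k ds ds′ = refl
bw-kids x black k ds ds′ = refl

mutual
  size-contract : ∀ u v t → size (contract u v t) ≡ size t
  size-contract u v (node x c k cs) with u ≟ x
  ... | yes _ = trans (+-assoc (bw (node x c k cs)) (weightOfKid v cs) (sizeF (contractKids v cs)))
                      (cong (bw (node x c k cs) +_) (contractKids-size v cs))
  ... | no _ = cong₂ _+_ (bw-kids x c k (contractF u v cs) cs) (sizeF-contractF u v cs)

  sizeF-contractF : ∀ u v ts → sizeF (contractF u v ts) ≡ sizeF ts
  sizeF-contractF u v [] = refl
  sizeF-contractF u v (t ∷ ts) = cong₂ _+_ (size-contract u v t) (sizeF-contractF u v ts)

contractKids-labels⊆ : ∀ v cs {y} → y ∈ labelsF (contractKids v cs) → y ∈ labelsF cs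
contractKids-labels⊆ v (t ∷ ts) m with kidView v t
contractKids-labels⊆ v (node y c k ds ∷ ts) m | is-v e _ rewrite e | labelsF-++ ds (contractKids v ts)
  with ∈-++⁻ (labelsF ds) m
... | inj₁ m₁ = ∈-++⁺ˡ (there m₁)
... | inj₂ m₂ = ∈-++⁺ʳ (y ∷ labelsF ds) (contractKids-labels⊆ v ts m₂)
contractKids-labels⊆ v (t ∷ ts) m | not-v e _ rewrite e with ∈-++⁻ (labels t) m
... | inj₁ m₁ = ∈-++⁺ˡ m₁
... | inj₂ m₂ = ∈-++⁺ʳ (labels t) (contractKids-labels⊆ v ts m₂)

mutual
  contract-labels⊆ : ∀ u v t {y} → y ∈ labels (contract u v t) → y ∈ labels t
  contract-labels⊆ u v (node x c k cs) m with u ≟ x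
  contract-labels⊆ u v (node x c k cs) (here y≡x) | yes _ = here y≡x
  contract-labels⊆ u v (node x c k cs) (here y≡x) | no _ = here y≡x
  contract-labels⊆ u v (node x c k cs) (there m) | yes _ = there (contractKids-labels⊆ v cs m)
  contract-labels⊆ u v (node x c k cs) (there m) | no _ = there (contractF-labels⊆ u v cs m)

  contractF-labels⊆ : ∀ u v ts {y} → y ∈ labelsF (contractF u v ts) → y ∈ labelsF ts
  contractF-labels⊆ u v (t ∷ ts) m with ∈-++⁻ (labels (contract u v t)) m
  ... | inj₁ m₁ = ∈-++⁺ˡ (contract-labels⊆ u v t m₁)
  ... | inj₂ m₂ = ∈-++⁺ʳ (labels t) (contractF-labels⊆ u v ts m₂)

contractKids-distinct : ∀ v cs → DistinctF cs → DistinctF (contractKids v cs)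
contractKids-distinct v [] _ = tt
contractKids-distinct v (t ∷ ts) d with kidView v t
contractKids-distinct v (node y c k ds ∷ ts) (dt , dts , dj) | is-v e _ rewrite e =
  DistinctF-++ ds (contractKids v ts) (proj₂ dt) (contractKids-distinct v ts dts)
               (λ m n → dj (there m) (contractKids-labels⊆ v ts n))
contractKids-distinct v (t ∷ ts) (dt , dts , dj) | not-v e _ rewrite e =
  dt , contractKids-distinct v ts dts , (λ m n → dj m (contractKids-labels⊆ v ts n))

mutual
  contract-distinct : ∀ u v t → Distinct t → Distinct (contract u v t)
  contract-distinct u v (node x c k cs) (x∉ , d) with u ≟ x
  ... | yes _ = (λ m → x∉ (contractKids-labels⊆ v cs m)) , contractKids-distinct v cs d
  ... | no _ = (λ m → x∉ (contractF-labels⊆ u v cs m)) , contractF-distinct u v cs d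

  contractF-distinct : ∀ u v ts → DistinctF ts → DistinctF (contractF u v ts)
  contractF-distinct u v [] _ = tt
  contractF-distinct u v (t ∷ ts) (dt , dts , dj) =
    contract-distinct u v t dt , contractF-distinct u v ts dts ,
    (λ m n → dj (contract-labels⊆ u v t m) (contractF-labels⊆ u v ts n))

contractKids-grandchild : ∀ v cs {tv tc} → tv ∈ cs → label tv ≡ v → tc ∈ children tv → tc ∈ contractKids v cs
contractKids-grandchild v (t ∷ ts) p lv q with kidView v t
contractKids-grandchild v (node y c k ds ∷ ts) (here refl) lv q | is-v e _ rewrite e = ∈-++⁺ˡ q
contractKids-grandchild v (node y c k ds ∷ ts) (there p) lv q | is-v e _ rewrite e =
  ∈-++⁺ʳ ds (contractKids-grandchild v ts p lv q)
contractKids-grandchild v (t ∷ ts) (here refl) lv q | not-v e t≢v = ⊥-elim (t≢v lv)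
contractKids-grandchild v (t ∷ ts) (there p) lv q | not-v e _ rewrite e = there (contractKids-grandchild v ts p lv q)

contractKids-sibling : ∀ v cs {t} → t ∈ cs → label t ≢ v → t ∈ contractKids v cs
contractKids-sibling v (t ∷ ts) p t≢v with kidView v t
contractKids-sibling v (t ∷ ts) (here refl) t≢v | is-v e t≡v = ⊥-elim (t≢v t≡v)
contractKids-sibling v (node y c k ds ∷ ts) (there p) t≢v | is-v e _ rewrite e = ∈-++⁺ʳ ds (contractKids-sibling v ts p t≢v)
contractKids-sibling v (t ∷ ts) (here refl) t≢v | not-v e _ rewrite e = here refl
contractKids-sibling v (t ∷ ts) (there p) t≢v | not-v e _ rewrite e = there (contractKids-sibling v ts p t≢v)

module _ (ms : List ℕ) where
  moved kept : List Tree → List Tree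
  moved cs = filter (λ t → label t ∈? ms) cs
  kept cs = filter (λ t → ¬? (label t ∈? ms)) cs

  moved-kept-apart : ∀ cs {y} → DistinctF cs → y ∈ labelsF (moved cs) → y ∉ labelsF (kept cs)
  moved-kept-apart cs d m n with ∈-labelsF⁻ _ m | ∈-labelsF⁻ _ n
  ... | t₁ , t₁∈ , m₁ | t₂ , t₂∈ , m₂ with ∈-filter⁻ (λ t → label t ∈? ms) t₁∈ | ∈-filter⁻ (λ t → ¬? (label t ∈? ms)) t₂∈
  ...   | t₁∈cs , t₁-moved | t₂∈cs , t₂-kept =
          t₂-kept (subst (λ t → label t ∈ ms) (shared-label⇒same d t₁∈cs t₂∈cs m₁ m₂) t₁-moved)

mutual
  split-absent : ∀ u v ms t → u ∉ labels t → split u v ms t ≡ t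
  split-absent u v ms (node x c k cs) u∉ with u ≟ x
  ... | yes u≡x = ⊥-elim (u∉ (here u≡x))
  ... | no _ = cong (node x c k) (splitF-absent u v ms cs (λ m → u∉ (there m)))

  splitF-absent : ∀ u v ms ts → u ∉ labelsF ts → splitF u v ms ts ≡ ts
  splitF-absent u v ms [] _ = refl
  splitF-absent u v ms (t ∷ ts) u∉ =
    cong₂ _∷_ (split-absent u v ms t (λ m → u∉ (∈-++⁺ˡ m))) (splitF-absent u v ms ts (λ m → u∉ (∈-++⁺ʳ (labels t) m)))

mutual
  split-labels⊆ : ∀ u v ms t {y} → y ∈ labels (split u v ms t) → y ≡ v ⊎ y ∈ labels t
  split-labels⊆ u v ms (node x c k cs) m with u ≟ x
  split-labels⊆ u v ms (node x c k cs) (here y≡x) | yes _ = inj₂ (here y≡x)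
  split-labels⊆ u v ms (node x c k cs) (there (here y≡v)) | yes _ = inj₁ y≡v
  split-labels⊆ u v ms (node x c k cs) (there (there m)) | yes _ with ∈-++⁻ (labelsF (moved ms cs)) m
  ... | inj₁ m₁ = inj₂ (there (labelsF-⊆ (filter-⊆ _ cs) m₁))
  ... | inj₂ m₂ = inj₂ (there (labelsF-⊆ (filter-⊆ _ cs) m₂))
  split-labels⊆ u v ms (node x c k cs) (here y≡x) | no _ = inj₂ (here y≡x)
  split-labels⊆ u v ms (node x c k cs) (there m) | no _ with splitF-labels⊆ u v ms cs m
  ... | inj₁ y≡v = inj₁ y≡v
  ... | inj₂ m′ = inj₂ (there m′)

  splitF-labels⊆ : ∀ u v ms ts {y} → y ∈ labelsF (splitF u v ms ts) → y ≡ v ⊎ y ∈ labelsF ts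
  splitF-labels⊆ u v ms (t ∷ ts) m with ∈-++⁻ (labels (split u v ms t)) m
  ... | inj₁ m₁ with split-labels⊆ u v ms t m₁
  ...   | inj₁ y≡v = inj₁ y≡v
  ...   | inj₂ m′ = inj₂ (∈-++⁺ˡ m′)
  splitF-labels⊆ u v ms (t ∷ ts) m | inj₂ m₂ with splitF-labels⊆ u v ms ts m₂
  ...   | inj₁ y≡v = inj₁ y≡v
  ...   | inj₂ m′ = inj₂ (∈-++⁺ʳ (labels t) m′)

mutual
  split-distinct : ∀ u v ms t → Distinct t → v ∉ labels t → Distinct (split u v ms t)
  split-distinct u v ms (node x c k cs) (x∉ , d) v∉ with u ≟ x
  ... | yes _ = x∉′ , (v∉moved , DistinctF-⊆ (filter-⊆ _ cs) d) , DistinctF-⊆ (filter-⊆ _ cs) d , apart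
    where
    v∉moved : v ∉ labelsF (moved ms cs)
    v∉moved m = v∉ (there (labelsF-⊆ (filter-⊆ _ cs) m))
    x∉′ : x ∉ (v ∷ labelsF (moved ms cs)) ++ labelsF (kept ms cs)
    x∉′ (here x≡v) = v∉ (here (sym x≡v))
    x∉′ (there m) with ∈-++⁻ (labelsF (moved ms cs)) m
    ... | inj₁ m₁ = x∉ (labelsF-⊆ (filter-⊆ _ cs) m₁)
    ... | inj₂ m₂ = x∉ (labelsF-⊆ (filter-⊆ _ cs) m₂)
    apart : ∀ {y} → y ∈ v ∷ labelsF (moved ms cs) → y ∉ labelsF (kept ms cs)
    apart (here refl) n = v∉ (there (labelsF-⊆ (filter-⊆ _ cs) n))
    apart (there m) n = moved-kept-apart ms cs d m n
  ... | no _ = x∉′ , splitF-distinct u v ms cs d (λ m → v∉ (there m))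
    where
    x∉′ : x ∉ labelsF (splitF u v ms cs)
    x∉′ m with splitF-labels⊆ u v ms cs m
    ... | inj₁ x≡v = v∉ (here (sym x≡v))
    ... | inj₂ m′ = x∉ m′

  splitF-distinct : ∀ u v ms ts → DistinctF ts → v ∉ labelsF ts → DistinctF (splitF u v ms ts)
  splitF-distinct u v ms [] _ _ = tt
  splitF-distinct u v ms (t ∷ ts) (dt , dts , dj) v∉ =
    split-distinct u v ms t dt (λ m → v∉ (∈-++⁺ˡ m)) , splitF-distinct u v ms ts dts (λ m → v∉ (∈-++⁺ʳ (labels t) m)) , apart
    where
    -- u lies in at most one of t and ts, so at most one side gains the label v
    apart : ∀ {y} → y ∈ labels (split u v ms t) → y ∉ labelsF (splitF u v ms ts)
    apart m n with u ∈? labels t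
    ... | yes u∈t rewrite splitF-absent u v ms ts (dj u∈t) with split-labels⊆ u v ms t m
    ...   | inj₁ refl = v∉ (∈-++⁺ʳ (labels t) n)
    ...   | inj₂ m′ = dj m′ n
    apart m n | no u∉t rewrite split-absent u v ms t u∉t with splitF-labels⊆ u v ms ts n
    ...   | inj₁ refl = v∉ (∈-++⁺ˡ m)
    ...   | inj₂ n′ = dj m n′

leaf : ℕ → Tree
leaf i = node (suc i) black 1 []

labelsF-leaves : ∀ L → labelsF (map leaf L) ≡ map suc L
labelsF-leaves [] = refl
labelsF-leaves (i ∷ L) = cong (suc i ∷_) (labelsF-leaves L)

leaves-distinct : ∀ L → Unique L → DistinctF (map leaf L)
leaves-distinct [] _ = tt
leaves-distinct (i ∷ L) (i∉L ∷ uL) = ((λ ()) , tt) , leaves-distinct L uL , apart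
  where
  apart : ∀ {y} → y ∈ labels (leaf i) → y ∉ labelsF (map leaf L)
  apart (here refl) n rewrite labelsF-leaves L with ∈-map⁻ suc n
  ... | j , j∈L , si≡sj = All.lookup i∉L j∈L (suc-injective si≡sj)

star-distinct : ∀ B → Distinct (star B)
star-distinct B = root∉ , leaves-distinct (upTo B) (upTo⁺ B)
  where
  root∉ : 0 ∉ labelsF (map leaf (upTo B))
  root∉ m rewrite labelsF-leaves (upTo B) with ∈-map⁻ suc m
  ... | _ , _ , ()

reachable-distinct : ∀ {B T} → Reachable B T → Distinct T
reachable-distinct start = star-distinct _
reachable-distinct (splitStep R u _ _ _ v v∉ _ _ _ _ _ _ _ _) = split-distinct u v _ _ (reachable-distinct R) v∉
reachable-distinct (contractStep R u v _) = contract-distinct u v _ (reachable-distinct R)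

-- Contracting at u changes neither sizes nor light bits on the
-- root path of u, so below u both searches proceed from the same depth d, and away from
-- T_u nothing changes.
size-contract-below : ∀ u v x c k cs → size (node x c k (contractF u v cs)) ≡ size (node x c k cs)
size-contract-below u v x c k cs = cong₂ _+_ (bw-kids x c k (contractF u v cs) cs) (sizeF-contractF u v cs)

-- d is the starting depth of T_u when the search in T starts at depth a, before and
-- after the contraction.
EntersAt : ℕ → ℕ → ℕ → Tree → Tree → ℕ → Set
EntersAt u v a T tu d = ∀ {w} → w ∈ labels tu →
  (ldAcc w a T ≡ ldAcc w d tu) × (ldAcc w a (contract u v T) ≡ ldAcc w d (contract u v tu))

EntersAtF : ℕ → ℕ → ℕ → ℕ → List Tree → Tree → ℕ → Set
EntersAtF u v a sp ts tu d = ∀ {w} → w ∈ labels tu →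
  (ldF w a sp ts ≡ ldAcc w d tu) × (ldF w a sp (contractF u v ts) ≡ ldAcc w d (contract u v tu))

mutual
  descend : ∀ {u v} T {tu} → Distinct T → find u T ≡ just tu → ∀ a → Σ ℕ (EntersAt u v a T tu)
  descend {u} {v} (node x c k cs) d e a with u ≟ x
  descend {u} {v} (node x c k cs) d refl a | yes u≡x = a , λ {w} _ → refl , cong (ldAcc w a) (sym (contract-here u≡x))
  ... | no _ with descendF {u} {v} cs (proj₂ d) e a (size (node x c k cs))
  ...   | d′ , enters = d′ , λ {w} m →
          let w≢x = λ w≡x → proj₁ d (subst (_∈ labelsF cs) w≡x (foundF-labels⊆ cs e m)) in
          trans (ldAcc-skip w≢x) (proj₁ (enters m)) ,
          trans (ldAcc-skip w≢x) (trans (cong (λ s → ldF w a s (contractF u v cs)) (size-contract-below u v x c k cs))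
                                        (proj₂ (enters m)))

  descendF : ∀ {u v} ts {tu} → DistinctF ts → findF u ts ≡ just tu → ∀ a sp → Σ ℕ (EntersAtF u v a sp ts tu)
  descendF {u} {v} (t ∷ ts) (dt , dts , dj) e a sp with findF-cons⁻ u t ts e
  ... | inj₁ e₁ with descend {u} {v} t dt e₁ (a + lightBit (size t) sp)
  ...   | d′ , enters = d′ , λ {w} m →
          let w∉ts = dj (found-labels⊆ t e₁ m) in
          trans (ldF-first w a sp t ts w∉ts) (proj₁ (enters m)) ,
          trans (cong (λ ts′ → ldF w a sp (contract u v t ∷ ts′)) (contractF-absent u v ts (dj (found∈labels t e₁))))
            (trans (ldF-first w a sp (contract u v t) ts w∉ts)
              (trans (cong (λ s → ldAcc w (a + lightBit s sp) (contract u v t)) (size-contract u v t)) (proj₂ (enters m))))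
  descendF {u} {v} (t ∷ ts) (dt , dts , dj) e a sp | inj₂ e₂ with descendF {u} {v} ts dts e₂ a sp
  ...   | d′ , enters = d′ , λ {w} m →
          let w∉t = λ w∈t → dj w∈t (foundF-labels⊆ ts e₂ m) in
          trans (ldF-later w a sp t ts w∉t) (proj₁ (enters m)) ,
          trans (cong (λ t′ → ldF w a sp (t′ ∷ contractF u v ts)) (contract-absent u v t (λ u∈t → dj u∈t (foundF∈labels ts e₂))))
            (trans (ldF-later w a sp t (contractF u v ts) w∉t) (proj₂ (enters m)))

mutual
  contract-outside : ∀ {u v w} T {tu} → Distinct T → find u T ≡ just tu → w ∉ labels tu → ∀ a →
                     ldAcc w a (contract u v T) ≡ ldAcc w a T
  contract-outside {u} {v} {w} (node x c k cs) d e w∉ a with u ≟ x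
  contract-outside {u} {v} {w} (node x c k cs) d refl w∉ a | yes _ =
    trans (ldAcc-absent a _ w∉′) (sym (ldAcc-absent a (node x c k cs) w∉))
    where
    w∉′ : w ∉ x ∷ labelsF (contractKids v cs)
    w∉′ (here w≡x) = w∉ (here w≡x)
    w∉′ (there m) = w∉ (there (contractKids-labels⊆ v cs m))
  ... | no _ with w ≟ x
  ...   | yes _ = refl
  ...   | no _ rewrite size-contract-below u v x c k cs = contractF-outside cs (proj₂ d) e w∉ a _

  contractF-outside : ∀ {u v w} ts {tu} → DistinctF ts → findF u ts ≡ just tu → w ∉ labels tu → ∀ a sp →
                      ldF w a sp (contractF u v ts) ≡ ldF w a sp ts
  contractF-outside {u} {v} {w} (t ∷ ts) (dt , dts , dj) e w∉ a sp with findF-cons⁻ u t ts e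
  ... | inj₁ e₁
    rewrite contractF-absent u v ts (dj (found∈labels t e₁))
          | ldF-cons w a sp (contract u v t) ts | ldF-cons w a sp t ts | size-contract u v t
          | contract-outside {u} {v} t dt e₁ w∉ (a + lightBit (size t) sp) = refl
  ... | inj₂ e₂
    rewrite contract-absent u v t (λ u∈t → dj u∈t (foundF∈labels ts e₂))
          | ldF-cons w a sp t (contractF u v ts) | ldF-cons w a sp t ts
          | contractF-outside {u} {v} ts dts e₂ w∉ a sp = refl

ldAcc-child : ∀ {w} d t {tc} → Distinct t → tc ∈ children t → w ∈ labels tc →
              ldAcc w d t ≡ ldAcc w (d + lightBit (size tc) (size t)) tc
ldAcc-child d (node x c k cs) (x∉ , ds) tc∈ m =
  trans (ldAcc-skip (λ w≡x → x∉ (subst (_∈ labelsF cs) w≡x (∈-labelsF⁺ tc∈ m)))) (ldF-member d _ cs ds tc∈ m)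

ldAcc-contracted-child : ∀ {u v w} d tu {t} → label tu ≡ u → Distinct tu → t ∈ contractKids v (children tu) →
                         w ∈ labels t → ldAcc w d (contract u v tu) ≡ ldAcc w (d + lightBit (size t) (size tu)) t
ldAcc-contracted-child {v = v} {w} d tu@(node x c k cs) {t} refl (x∉ , ds) t∈ m =
  begin
    ldAcc w d (contract x v tu)                               ≡⟨ cong (ldAcc w d) (contract-here refl) ⟩
    ldAcc w d tu′                                             ≡⟨ ldAcc-child d tu′ dtu′ t∈ m ⟩
    ldAcc w (d + lightBit (size t) (size tu′)) t               ≡⟨ cong (λ s → ldAcc w (d + lightBit (size t) s) t) size-tu′ ⟩
    ldAcc w (d + lightBit (size t) (size tu)) t                ∎
  where
  open ≡-Reasoning
  tu′ = node x black (bw tu + weightOfKid v cs) (contractKids v cs)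
  dtu′ : Distinct tu′
  dtu′ = (λ m′ → x∉ (contractKids-labels⊆ v cs m′)) , contractKids-distinct v cs ds
  size-tu′ : size tu′ ≡ size tu
  size-tu′ = trans (cong size (sym (contract-here {x} {v} {x} {c} {k} {cs} refl))) (size-contract x v tu)

ldAcc-contract-through : ∀ {u v w} d tu {tv tc} → label tu ≡ u → Distinct tu → tv ∈ children tu → label tv ≡ v →
  tc ∈ children tv → w ∈ labels tc →
  (ldAcc w d tu ≡ ldAcc w (d + lightBit (size tv) (size tu) + lightBit (size tc) (size tv)) tc)
  × (ldAcc w d (contract u v tu) ≡ ldAcc w (d + lightBit (size tc) (size tu)) tc)
ldAcc-contract-through d tu@(node _ _ _ cs) {tv} root dtu tv∈ lv tc∈ m =
  trans (ldAcc-child d tu dtu tv∈ (∈-children⇒∈-labels tv tc∈ m))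
        (ldAcc-child _ tv (DistinctF-member (proj₂ dtu) tv∈) tc∈ m) ,
  ldAcc-contracted-child d tu root dtu (contractKids-grandchild _ cs tv∈ lv tc∈) m

ldAcc-contract-away : ∀ {u v w} d tu {tv} → label tu ≡ u → Distinct tu → tv ∈ children tu → label tv ≡ v →
                      w ∈ labels tu → w ∉ labels tv → ldAcc w d (contract u v tu) ≡ ldAcc w d tu
ldAcc-contract-away {v = v} {w} d tu@(node x c k cs) refl dtu tv∈ lv (here w≡x) w∉tv =
  trans (cong (ldAcc w d) (contract-here {x} {v} {x} {c} {k} {cs} refl)) (trans (ldAcc-here w≡x) (sym (ldAcc-here w≡x)))
ldAcc-contract-away {v = v} d tu@(node x c k cs) {tv} refl dtu tv∈ lv (there m) w∉tv with ∈-labelsF⁻ cs m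
... | t , t∈ , m′ with label t ≟ v
...   | yes t≡v = ⊥-elim (w∉tv (subst (λ t′ → _ ∈ labels t′) t≡tv m′))
  where
  t≡tv : t ≡ tv
  t≡tv = shared-label⇒same (proj₂ dtu) t∈ tv∈ (label∈labels t≡v) (label∈labels lv)
...   | no t≢v = trans (ldAcc-contracted-child d tu refl dtu (contractKids-sibling v cs t∈ t≢v) m′)
                       (sym (ldAcc-child d tu dtu t∈ m′))

light-bit : ∀ sc {sp} → 2 * sc ≤ sp → lightBit sc sp ≡ 1
light-bit sc {sp} light with 2 * sc ≤? sp
... | yes _ = refl
... | no heavy = ⊥-elim (heavy light)

heavy-bit : ∀ sc {sp} → ¬ (2 * sc ≤ sp) → lightBit sc sp ≡ 0
heavy-bit sc {sp} heavy with 2 * sc ≤? sp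
... | yes light = ⊥-elim (heavy light)
... | no _ = refl

size-child : ∀ t {tc} → tc ∈ children t → size tc ≤ size t
size-child (node x c k cs) tc∈ = ≤-trans (sizeF-member cs tc∈) (m≤n+m (sizeF cs) (bw (node x c k cs)))
  where
  sizeF-member : ∀ ts {t} → t ∈ ts → size t ≤ sizeF ts
  sizeF-member (t ∷ ts) (here refl) = m≤m+n (size t) (sizeF ts)
  sizeF-member (t ∷ ts) (there p) = ≤-trans (sizeF-member ts p) (m≤n+m (sizeF ts) (size t))

sz-found : ∀ T {y t} → find y T ≡ just t → sz T y ≡ size t
sz-found T = cong (maybe size 0)

subtreeLabels-found : ∀ T {y t} → find y T ≡ just t → subtreeLabels T y ≡ labels t
subtreeLabels-found T = cong (maybe labels [])

module _ (T : Tree) {c p tc tp} (fc : find c T ≡ just tc) (fp : find p T ≡ just tp) where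
  light-sizes : LightEdge T c p → 2 * size tc ≤ size tp
  light-sizes = subst₂ (λ a b → 2 * a ≤ b) (sz-found T fc) (sz-found T fp)

  heavy-sizes : HeavyEdge T c p → ¬ (2 * size tc ≤ size tp)
  heavy-sizes heavy = <⇒≱ (subst₂ (λ a b → b < 2 * a) (sz-found T fc) (sz-found T fp) heavy)

  light-edge : 2 * size tc ≤ size tp → LightEdge T c p
  light-edge = subst₂ (λ a b → 2 * a ≤ b) (sym (sz-found T fc)) (sym (sz-found T fp))

  heavy-edge : ¬ (2 * size tc ≤ size tp) → HeavyEdge T c p
  heavy-edge heavy = subst₂ (λ a b → b < 2 * a) (sym (sz-found T fc)) (sym (sz-found T fp)) (≰⇒> heavy)

module ContractedEdge {T u v tu tv} (dT : Distinct T) (fu : find u T ≡ just tu)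
                      (tv∈ : tv ∈ children tu) (lv : label tv ≡ v) where

  dtu : Distinct tu
  dtu = found-distinct T dT fu

  fv : find v T ≡ just tv
  fv = subst (λ y → find y T ≡ just tv) lv (find-child T dT fu tv∈)

  grandchild : ∀ {c w} → ChildOf T c v → w ∈ subtreeLabels T c →
               Σ Tree λ tc → tc ∈ children tv × w ∈ labels tc × find c T ≡ just tc
  grandchild (tv′ , fv′ , c∈) wm with just-injective (trans (sym fv′) fv)
  ... | refl with ∈-map⁻ label c∈
  ...   | tc , tc∈ , refl = tc , tc∈ , subst (_ ∈_) (subtreeLabels-found T fc) wm , fc
    where fc = find-child T dT fv tc∈

  through-v : ∀ {tc w} → tc ∈ children tv → w ∈ labels tc → Σ ℕ λ d →
    (lightDepth T w ≡ ldAcc w (d + lightBit (size tv) (size tu) + lightBit (size tc) (size tv)) tc)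
    × (lightDepth (contract u v T) w ≡ ldAcc w (d + lightBit (size tc) (size tu)) tc)
  through-v tc∈ m with descend {u} {v} T dT fu 0
  ... | d , enters =
        d , trans (proj₁ (enters m-tu)) (proj₁ local) , trans (proj₂ (enters m-tu)) (proj₂ local)
    where
    m-tu = ∈-children⇒∈-labels tu tv∈ (∈-children⇒∈-labels tv tc∈ m)
    local = ldAcc-contract-through d tu (found-label T fu) dtu tv∈ lv tc∈ m

  elsewhere : ∀ {w} → w ∉ labels tv → lightDepth (contract u v T) w ≡ lightDepth T w
  elsewhere {w} w∉tv with w ∈? labels tu
  ... | no w∉tu = contract-outside T dT fu w∉tu 0
  ... | yes w∈tu with descend {u} {v} T dT fu 0
  ...   | d , enters =
          trans (proj₂ (enters w∈tu))
                (trans (ldAcc-contract-away d tu (found-label T fu) dtu tv∈ lv w∈tu w∉tv) (sym (proj₁ (enters w∈tu))))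

  light-contraction : LightEdge T v u → (c : ℕ) → ChildOf T c v → LightEdge T c v →
    (w : ℕ) → w ∈ subtreeLabels T c →
    Σ ℕ λ k → lightDepth T w ≡ just (suc k) × lightDepth (contract u v T) w ≡ just k
  light-contraction vu-light c cc cv-light w wm with grandchild cc wm
  ... | tc , tc∈ , m , fc with through-v tc∈ m
  ...   | d , before , after with ldAcc-defined (d + 1) tc m
  ...     | k , found = k , before′ , after′
    where
    open ≡-Reasoning
    c-light : 2 * size tc ≤ size tv
    c-light = light-sizes T fc fv cv-light
    vu-bit : lightBit (size tv) (size tu) ≡ 1
    vu-bit = light-bit (size tv) (light-sizes T fv fu vu-light)
    cv-bit : lightBit (size tc) (size tv) ≡ 1
    cv-bit = light-bit (size tc) c-light
    cu-bit : lightBit (size tc) (size tu) ≡ 1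
    cu-bit = light-bit (size tc) (≤-trans c-light (size-child tu tv∈))
    before′ : lightDepth T w ≡ just (suc k)
    before′ = begin
      lightDepth T w                     ≡⟨ before ⟩
      ldAcc w (d + _ + _) tc             ≡⟨ cong₂ (λ b₁ b₂ → ldAcc w (d + b₁ + b₂) tc) vu-bit cv-bit ⟩
      ldAcc w (d + 1 + 1) tc             ≡⟨ cong (λ a → ldAcc w a tc) (+-comm (d + 1) 1) ⟩
      ldAcc w (suc (d + 1)) tc           ≡⟨ ldAcc-suc w (d + 1) tc ⟩
      mapMaybe suc (ldAcc w (d + 1) tc)  ≡⟨ cong (mapMaybe suc) found ⟩
      just (suc k)                       ∎
    after′ : lightDepth (contract u v T) w ≡ just k
    after′ = begin
      lightDepth (contract u v T) w  ≡⟨ after ⟩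
      ldAcc w (d + _) tc             ≡⟨ cong (λ b → ldAcc w (d + b) tc) cu-bit ⟩
      ldAcc w (d + 1) tc             ≡⟨ found ⟩
      just k                         ∎

  heavy-contraction : HeavyEdge T v u → (c : ℕ) → ChildOf T c v → HeavyEdge T c v → 2 * sz T c ≤ sz T u →
    (w : ℕ) → w ∈ subtreeLabels T c →
    Σ ℕ λ k → lightDepth T w ≡ just k × lightDepth (contract u v T) w ≡ just (suc k)
  heavy-contraction vu-heavy c cc cv-heavy cu-light w wm with grandchild cc wm
  ... | tc , tc∈ , m , fc with through-v tc∈ m
  ...   | d , before , after with ldAcc-defined d tc m
  ...     | k , found = k , before′ , after′
    where
    open ≡-Reasoning
    vu-bit : lightBit (size tv) (size tu) ≡ 0
    vu-bit = heavy-bit (size tv) (heavy-sizes T fv fu vu-heavy)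
    cv-bit : lightBit (size tc) (size tv) ≡ 0
    cv-bit = heavy-bit (size tc) (heavy-sizes T fc fv cv-heavy)
    cu-bit : lightBit (size tc) (size tu) ≡ 1
    cu-bit = light-bit (size tc) (light-sizes T fc fu cu-light)
    before′ : lightDepth T w ≡ just k
    before′ = begin
      lightDepth T w          ≡⟨ before ⟩
      ldAcc w (d + _ + _) tc  ≡⟨ cong₂ (λ b₁ b₂ → ldAcc w (d + b₁ + b₂) tc) vu-bit cv-bit ⟩
      ldAcc w (d + 0 + 0) tc  ≡⟨ cong (λ a → ldAcc w a tc) (trans (+-identityʳ (d + 0)) (+-identityʳ d)) ⟩
      ldAcc w d tc            ≡⟨ found ⟩
      just k                  ∎
    after′ : lightDepth (contract u v T) w ≡ just (suc k)
    after′ = begin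
      lightDepth (contract u v T) w  ≡⟨ after ⟩
      ldAcc w (d + _) tc             ≡⟨ cong (λ b → ldAcc w (d + b) tc) cu-bit ⟩
      ldAcc w (d + 1) tc             ≡⟨ cong (λ a → ldAcc w a tc) (+-comm d 1) ⟩
      ldAcc w (suc d) tc             ≡⟨ ldAcc-suc w d tc ⟩
      mapMaybe suc (ldAcc w d tc)    ≡⟨ cong (mapMaybe suc) found ⟩
      just (suc k)                   ∎

  -- (3) Otherwise, when v→u is heavy, for every child tc of v the bit of tc→u equals the
  -- two bits of tc→v→u, so no light depth changes.
  heavy-contraction-rest : HeavyEdge T v u → ¬ (Σ ℕ λ c → ChildOf T c v × HeavyEdge T c v × 2 * sz T c ≤ sz T u) →
    (w : ℕ) → w ∈ labels T → w ≢ v → lightDepth (contract u v T) w ≡ lightDepth T w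
  heavy-contraction-rest vu-heavy no-shallow w _ w≢v with w ∈? labels tv
  ... | no w∉tv = elsewhere w∉tv
  ... | yes w∈tv with ∈-labels⁻ tv w∈tv
  ...   | inj₁ w≡v = ⊥-elim (w≢v (trans w≡v lv))
  ...   | inj₂ (tc , tc∈ , m) with through-v tc∈ m
  ...     | d , before , after = begin
      lightDepth (contract u v T) w  ≡⟨ after ⟩
      ldAcc w (d + cu) tc            ≡⟨ cong (λ b → ldAcc w (d + b) tc) (sym merged) ⟩
      ldAcc w (d + (vu + cv)) tc     ≡⟨ cong (λ a → ldAcc w a tc) (sym (+-assoc d vu cv)) ⟩
      ldAcc w (d + vu + cv) tc       ≡⟨ sym before ⟩
      lightDepth T w                 ∎
    where
    open ≡-Reasoning
    fc = find-child T dT fv tc∈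
    vu cv cu : ℕ
    vu = lightBit (size tv) (size tu)
    cv = lightBit (size tc) (size tv)
    cu = lightBit (size tc) (size tu)
    vu-bit : vu ≡ 0
    vu-bit = heavy-bit (size tv) (heavy-sizes T fv fu vu-heavy)
    -- A light edge tc→v stays light towards u; a heavy one is heavy towards u as well,
    -- because tc is not a heavy child that is light with respect to u.
    merged : vu + cv ≡ cu
    merged = by-cv (2 * size tc ≤? size tv)
      where
      by-cv : Dec (2 * size tc ≤ size tv) → vu + cv ≡ cu
      by-cv (yes cv-light) = trans (cong₂ _+_ vu-bit (light-bit (size tc) cv-light))
                                   (sym (light-bit (size tc) (≤-trans cv-light (size-child tu tv∈))))
      by-cv (no cv-heavy) = trans (cong₂ _+_ vu-bit (heavy-bit (size tc) cv-heavy)) (sym (heavy-bit (size tc) cu-heavy))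
        where
        cu-heavy : ¬ (2 * size tc ≤ size tu)
        cu-heavy cu-light =
          no-shallow (label tc , (tv , fv , ∈-map⁺ label tc∈) , heavy-edge T fc fv cv-heavy , light-edge T fc fu cu-light)

lemma38 : (B : ℕ) (T : Tree) (u v : ℕ) → Reachable B T → ChildOf T v u →
    ((LightEdge T v u →
    (c : ℕ) → ChildOf T c v → LightEdge T c v →
    (w : ℕ) → w ∈ subtreeLabels T c →
    Σ ℕ λ k → lightDepth T w ≡ just (suc k) × lightDepth (contract u v T) w ≡ just k)
    × (HeavyEdge T v u →
    (c : ℕ) → ChildOf T c v → HeavyEdge T c v → 2 * sz T c ≤ sz T u →
    (w : ℕ) → w ∈ subtreeLabels T c →
    Σ ℕ λ k → lightDepth T w ≡ just k × lightDepth (contract u v T) w ≡ just (suc k))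
    × (HeavyEdge T v u →
    ¬ (Σ ℕ λ c → ChildOf T c v × HeavyEdge T c v × 2 * sz T c ≤ sz T u) →
    (w : ℕ) → w ∈ labels T → w ≢ v →
    lightDepth (contract u v T) w ≡ lightDepth T w))
lemma38 B T u v R (tu , fu , v∈) with ∈-map⁻ label v∈
... | tv , tv∈ , refl = light-contraction , heavy-contraction , heavy-contraction-rest
  where open ContractedEdge (reachable-distinct R) fu tv∈ refl
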